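{- The inhabitation algorithm for system $\mathcal H$ terminates: for every input (a judgement form $\mathtt T(\Gamma,\sigma)$, $\mathtt{TI}(\Gamma,A)$ or $\mathtt H^{x:[\rho]}(\Gamma,\tau)$), every attempted derivation (run) of the algorithm on that input is finite, and there are only finitely many possible runs (up to the choice of fresh bound variable names).
   Context: Types: $\sigma,\tau,\rho::=\alpha\mid A\to\tau$ with $\alpha$ from a countable set of base types and multiset types $A=[\sigma_i]_{i\in I}$ finite possibly empty multisets of types. Environments $\Gamma$ map variables to multiset types, all but finitely many to $[\,]$; $\mathrm{dom}(\Gamma)=\{x:\Gamma(x)\ne[\,]\}$; $\emptyset$ has empty domain; $(\Gamma+\Delta)(x)=\Gamma(x)\uplus\Delta(x)$; $x{:}A$ maps $x$ to $A$ and others to $[\,]$. Approximate normal forms: $a::=\Omega\mid N$, $N::=\lambda x.N\mid L$, $L::=x\mid L\,a$; $\le$ is the smallest order compatible with the constructors with $\Omega\le a$; $\bigvee$ is least upper bound, $\uparrow_{i\in I}a_i$ means it exists. The inhabitation algorithm for $\mathcal H$ is the deductive system with rules: (Abs) from $a\Vdash\mathtt T(\Gamma+x{:}A,\tau)$, $x\notin\mathrm{dom}(\Gamma)$, infer $\lambda x.a\Vdash\mathtt T(\Gamma,A\to\tau)$; (Union) from $(a_i\Vdash\mathtt T(\Gamma_i,\sigma_i))_{i\in I}$ and $\uparrow_{i\in I}a_i$ infer $\bigvee_{i\in I}a_i\Vdash\mathtt{TI}(+_{i\in I}\Gamma_i,[\sigma_i]_{i\in I})$; (Head$_{>0}$)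 from $\Gamma=\Gamma_1+\Gamma_2$, $a\Vdash\mathtt H^{x:[A_1\to\dots\to A_n\to B\to\tau]}(\Gamma_1,B\to\tau)$, $b\Vdash\mathtt{TI}(\Gamma_2,B)$, $n\ge0$, infer $ab\Vdash\mathtt H^{x:[A_1\to\dots\to A_n\to B\to\tau]}(\Gamma,\tau)$; (Head$_0$) $x\Vdash\mathtt H^{x:[\tau]}(\emptyset,\tau)$; (Head) from $a\Vdash\mathtt H^{x:[A_1\to\dots\to A_n\to\tau]}(\Gamma,\tau)$ infer $a\Vdash\mathtt T(\Gamma+x{:}[A_1\to\dots\to A_n\to\tau],\tau)$. A run on a given input is an attempt to build a derivation, bottom-up, whose conclusion is a judgement on that input with unknown approximate normal form $a$. -}

module Defs where

open import Data.Nat using (ℕ; zero; suc)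
open import Data.List using (List; []; _∷_; _++_; map; foldr)
open import Data.List.Relation.Unary.All using (All; []; _∷_)
open import Data.List.Membership.Propositional using (_∈_)
open import Data.Product using (Σ; _×_; _,_; proj₁; proj₂)
open import Data.Unit using (⊤)
open import Relation.Binary.PropositionalEquality using (_≡_)

-- Multisets are represented by lists; multiset equality is the
-- equivalence _≋_ below (permutation up to _≈_), and type equality _≈_
-- is syntactic equality up to _≋_ inside arrows.

Var : Set
Var = ℕ

data Ty : Set where
  base : ℕ → Ty
  _⇒_  : List Ty → Ty → Ty

infixr 5 _⇒_

MTy : Set
MTy = List Ty

data Sel : Ty → List Ty → List Ty → Set where
  here  : ∀ {σ B} → Sel σ (σ ∷ B) B
  there : ∀ {σ τ B B'} → Sel σ B B' → Sel σ (τ ∷ B) (τ ∷ B')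

mutual
  data _≈_ : Ty → Ty → Set where
    base : ∀ {a} → base a ≈ base a
    arr  : ∀ {A A' τ τ'} → A ≋ A' → τ ≈ τ' → (A ⇒ τ) ≈ (A' ⇒ τ')

  data _≋_ : MTy → MTy → Set where
    nil  : [] ≋ []
    cons : ∀ {σ σ' A B B'} → σ ≈ σ' → Sel σ' B B' → A ≋ B' → (σ ∷ A) ≋ B

-- Environments: Γ(x) is the x-th entry (default [ ]), so all but
-- finitely many variables are mapped to [ ].

Env : Set
Env = List MTy

get : Env → Var → MTy
get []      _       = []
get (A ∷ Γ) zero    = A
get (A ∷ Γ) (suc n) = get Γ n

_≈E_ : Env → Env → Set
Γ ≈E Δ = ∀ x → get Γ x ≋ get Δ x

∅ : Env
∅ = []

_⊕_ : Env → Env → Env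
[]      ⊕ Δ       = Δ
(A ∷ Γ) ⊕ []      = A ∷ Γ
(A ∷ Γ) ⊕ (B ∷ Δ) = (A ++ B) ∷ (Γ ⊕ Δ)

infixl 6 _⊕_

_↦_ : Var → MTy → Env
zero  ↦ A = A ∷ []
suc n ↦ A = [] ∷ (n ↦ A)

ΣEnv : List Env → Env
ΣEnv = foldr _⊕_ ∅

data Input : Set where
  T  : Env → Ty → Input
  TI : Env → MTy → Input
  H  : Var → Ty → Env → Ty → Input -- H^{x:[ρ]}(Γ, τ)  written  H x ρ Γ τ

data _≈I_ : Input → Input → Set where
  T  : ∀ {Γ Γ' σ σ'} → Γ ≈E Γ' → σ ≈ σ' → T Γ σ ≈I T Γ' σ'
  TI : ∀ {Γ Γ' A A'} → Γ ≈E Γ' → A ≋ A' → TI Γ A ≈I TI Γ' A'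
  H  : ∀ {x ρ ρ' Γ Γ' τ τ'} → ρ ≈ ρ' → Γ ≈E Γ' → τ ≈ τ' →
       H x ρ Γ τ ≈I H x ρ' Γ' τ'

data _≈Is_ : List Input → List Input → Set where
  []  : [] ≈Is []
  _∷_ : ∀ {i j is js} → i ≈I j → is ≈Is js → (i ∷ is) ≈Is (j ∷ js)

data Ends : Ty → List MTy → Ty → Set where
  done : ∀ {τ} → Ends τ [] τ
  step : ∀ {A ρ As τ} → Ends ρ As τ → Ends (A ⇒ ρ) (A ∷ As) τ

-- Rule instances, read bottom-up: Step i ps  means some rule of the
-- inhabitation algorithm has conclusion on input i and premises on the
-- inputs ps (in order).  The term component is the output and is not
-- part of the input.

TOf : Env × Ty → Input
TOf (Γ , σ) = T Γ σ

data Step : Input → List Input → Set where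
  abs   : ∀ {Γ A τ} (x : Var) → get Γ x ≡ [] →
          Step (T Γ (A ⇒ τ)) (T (Γ ⊕ (x ↦ A)) τ ∷ [])
  union : (ps : List (Env × Ty)) →
          Step (TI (ΣEnv (map proj₁ ps)) (map proj₂ ps)) (map TOf ps)
  head>0 : ∀ {x ρ As B τ} (Γ₁ Γ₂ : Env) → Ends ρ As (B ⇒ τ) →
          Step (H x ρ (Γ₁ ⊕ Γ₂) τ) (H x ρ Γ₁ (B ⇒ τ) ∷ TI Γ₂ B ∷ [])
  head0 : ∀ {x τ} → Step (H x τ ∅ τ) []
  head  : ∀ {x ρ As τ} (Γ : Env) → Ends ρ As τ →
          Step (T (Γ ⊕ (x ↦ (ρ ∷ []))) τ) (H x ρ Γ τ ∷ [])

Step≈ : Input → List Input → Set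
Step≈ i ps = Σ Input λ i' → Σ (List Input) λ ps' →
             i ≈I i' × ps ≈Is ps' × Step i' ps'

Premise : Input → Input → Set
Premise j i = Σ (List Input) λ ps → Step≈ i ps × j ∈ ps

-- Runs.  A fresh-name policy fixes the bound variable chosen by (Abs);
-- this realises "up to the choice of fresh bound variable names".

FreshOK : (Env → Var) → ∀ {i ps} → Step i ps → Set
FreshOK fresh (abs {Γ} x _) = x ≡ fresh Γ
FreshOK fresh (union _)      = ⊤
FreshOK fresh (head>0 _ _ _) = ⊤
FreshOK fresh head0          = ⊤
FreshOK fresh (head _ _)     = ⊤

-- A run on input i: a bottom-up attempted derivation, where each node is
-- either left unexpanded/failed (stop) or expanded by a rule instance
-- whose premises are again (attempted) runs.
data Run (fresh : Env → Var) : Input → Set where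
  stop : ∀ {i} → Run fresh i
  node : ∀ {i i' ps ps'} → i ≈I i' → ps ≈Is ps' → (s : Step i' ps') →
         FreshOK fresh s → All (Run fresh) ps → Run fresh i

data Tree : Set where
  pending : Input → Tree
  node    : Input → List Tree → Tree

mutual
  data _≈T_ : Tree → Tree → Set where
    pending : ∀ {i j} → i ≈I j → pending i ≈T pending j
    node    : ∀ {i j ts us} → i ≈I j → ts ≈Ts us → node i ts ≈T node j us

  data _≈Ts_ : List Tree → List Tree → Set where
    []  : [] ≈Ts []
    _∷_ : ∀ {t u ts us} → t ≈T u → ts ≈Ts us → (t ∷ ts) ≈Ts (u ∷ us)

mutual
  erase : ∀ {f i} → Run f i → Tree
  erase {i = i} stop = pending i
  erase {i = i} (node _ _ _ _ rs) = node i (eraseAll rs)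

  eraseAll : ∀ {f is} → All (Run f) is → List Tree
  eraseAll []       = []
  eraseAll (r ∷ rs) = erase r ∷ eraseAll rs

-- Termination: every rule strictly decreases a size measure on inputs.  Finiteness: along a run
-- the sizes of environments and types stay below a bound fixed by the input, and the variables
-- in the environments stay below a bound that grows with the depth only through the fresh names
-- chosen for finitely many environments; up to ≈I there are then finitely many inputs at each
-- depth, runs have bounded branching and bounded depth, hence finitely many shapes.
module Submission where

open import Defs
open import Data.Nat using (ℕ; zero; suc; _+_; _∸_; _≤_; _<_; z≤n; s≤s)
open import Data.Nat.Properties
open import Data.Nat.Induction using (<-wellFounded)
open import Data.List using (List; []; _∷_; _++_; map; length; take; upTo; concatMap)
open import Data.List.Properties using (++-identityʳ; ++-conicalˡ; ++-conicalʳ; length-map; length-take)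
open import Data.List.Extrema.Nat using (max; ⊥≤max; xs≤max)
open import Data.List.Relation.Unary.All as All using (All; []; _∷_)
import Data.List.Relation.Unary.All.Properties as Allₚ
open import Data.List.Relation.Unary.Any as Any using (Any; here; there)
import Data.List.Relation.Unary.Any.Properties as Anyₚ
open import Data.List.Relation.Binary.Pointwise using (Pointwise; []; _∷_; Pointwise-≡⇒≡)
open import Data.List.Membership.Propositional using (_∈_; lose)
open import Data.List.Membership.Propositional.Properties
  using (∈-map⁺; ∈-++⁺ˡ; ∈-++⁺ʳ; ∈-concatMap⁺; ∈-upTo⁺)
open import Data.Product using (Σ; _×_; _,_; proj₁; proj₂)
open import Data.Empty using (⊥-elim)
open import Function using (_∘_)
open import Relation.Binary.PropositionalEquality
open import Relation.Binary.Construct.On as On using ()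
open import Induction.WellFounded using (WellFounded; Acc; module Subrelation)
open import Algebra.Properties.CommutativeSemigroup +-commutativeSemigroup
  using (interchange; x∙yz≈y∙xz)

private
  variable
    σ τ : Ty
    A B B' : MTy
    Γ Δ : Env
    V W n : ℕ

-- Sizes

-- Counting the index of a base type makes every size class finite.
mutual
  sizeTy : Ty → ℕ
  sizeTy (base a) = suc a
  sizeTy (A ⇒ τ)  = suc (sizeMTy A + sizeTy τ)

  sizeMTy : MTy → ℕ
  sizeMTy []      = 0
  sizeMTy (σ ∷ A) = sizeTy σ + sizeMTy A

sizeEnv : Env → ℕ
sizeEnv []      = 0
sizeEnv (A ∷ Γ) = sizeMTy A + sizeEnv Γ

0<sizeTy : ∀ σ → 0 < sizeTy σ
0<sizeTy (base _) = s≤s z≤n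
0<sizeTy (_ ⇒ _)  = s≤s z≤n

length≤sizeMTy : ∀ A → length A ≤ sizeMTy A
length≤sizeMTy []      = z≤n
length≤sizeMTy (σ ∷ A) = +-mono-≤ (0<sizeTy σ) (length≤sizeMTy A)

∈⇒sizeTy≤sizeMTy : σ ∈ A → sizeTy σ ≤ sizeMTy A
∈⇒sizeTy≤sizeMTy (here refl) = m≤m+n _ _
∈⇒sizeTy≤sizeMTy {A = ρ ∷ _} (there σ∈A) = ≤-trans (∈⇒sizeTy≤sizeMTy σ∈A) (m≤n+m _ (sizeTy ρ))

∈⇒sizeMTy≤sizeEnv : A ∈ Γ → sizeMTy A ≤ sizeEnv Γ
∈⇒sizeMTy≤sizeEnv (here refl) = m≤m+n _ _
∈⇒sizeMTy≤sizeEnv {Γ = B ∷ _} (there A∈Γ) = ≤-trans (∈⇒sizeMTy≤sizeEnv A∈Γ) (m≤n+m _ (sizeMTy B))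

sizeMTy-++ : ∀ A B → sizeMTy (A ++ B) ≡ sizeMTy A + sizeMTy B
sizeMTy-++ []      B = refl
sizeMTy-++ (σ ∷ A) B = trans (cong (sizeTy σ +_) (sizeMTy-++ A B)) (sym (+-assoc (sizeTy σ) _ _))

sizeEnv-⊕ : ∀ Γ Δ → sizeEnv (Γ ⊕ Δ) ≡ sizeEnv Γ + sizeEnv Δ
sizeEnv-⊕ []      Δ       = refl
sizeEnv-⊕ (A ∷ Γ) []      = sym (+-identityʳ _)
sizeEnv-⊕ (A ∷ Γ) (B ∷ Δ) = begin
  sizeMTy (A ++ B) + sizeEnv (Γ ⊕ Δ)                  ≡⟨ cong₂ _+_ (sizeMTy-++ A B) (sizeEnv-⊕ Γ Δ) ⟩
  (sizeMTy A + sizeMTy B) + (sizeEnv Γ + sizeEnv Δ)   ≡⟨ interchange (sizeMTy A) _ _ _ ⟩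
  (sizeMTy A + sizeEnv Γ) + (sizeMTy B + sizeEnv Δ)   ∎
  where open ≡-Reasoning

sizeEnv≤⊕ˡ : ∀ Γ Δ → sizeEnv Γ ≤ sizeEnv (Γ ⊕ Δ)
sizeEnv≤⊕ˡ Γ Δ = ≤-trans (m≤m+n _ _) (≤-reflexive (sym (sizeEnv-⊕ Γ Δ)))

sizeEnv≤⊕ʳ : ∀ Γ Δ → sizeEnv Δ ≤ sizeEnv (Γ ⊕ Δ)
sizeEnv≤⊕ʳ Γ Δ = ≤-trans (m≤n+m _ _) (≤-reflexive (sym (sizeEnv-⊕ Γ Δ)))

sizeEnv-↦ : ∀ x A → sizeEnv (x ↦ A) ≡ sizeMTy A
sizeEnv-↦ zero    A = +-identityʳ _
sizeEnv-↦ (suc x) A = sizeEnv-↦ x A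

sizeEnv-⊕-↦ : ∀ Γ x A → sizeEnv (Γ ⊕ (x ↦ A)) ≡ sizeEnv Γ + sizeMTy A
sizeEnv-⊕-↦ Γ x A = trans (sizeEnv-⊕ Γ (x ↦ A)) (cong (sizeEnv Γ +_) (sizeEnv-↦ x A))

∈⇒sizeEnv≤sizeEnv-ΣEnv : ∀ {Γs} → Γ ∈ Γs → sizeEnv Γ ≤ sizeEnv (ΣEnv Γs)
∈⇒sizeEnv≤sizeEnv-ΣEnv {Γs = Γ ∷ Γs} (here refl) = sizeEnv≤⊕ˡ Γ (ΣEnv Γs)
∈⇒sizeEnv≤sizeEnv-ΣEnv {Γs = Δ ∷ Γs} (there Γ∈Γs) =
  ≤-trans (∈⇒sizeEnv≤sizeEnv-ΣEnv Γ∈Γs) (sizeEnv≤⊕ʳ Δ (ΣEnv Γs))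

Ends⇒sizeTy≤ : ∀ {ρ As} → Ends ρ As τ → sizeTy τ ≤ sizeTy ρ
Ends⇒sizeTy≤ done                = ≤-refl
Ends⇒sizeTy≤ (step {A} {ρ} ends) = ≤-trans (Ends⇒sizeTy≤ ends) (m≤n⇒m≤1+n (m≤n+m (sizeTy ρ) (sizeMTy A)))

Sel⇒sizeMTy≡ : Sel σ B B' → sizeMTy B ≡ sizeTy σ + sizeMTy B'
Sel⇒sizeMTy≡ here = refl
Sel⇒sizeMTy≡ {σ} (there {τ = τ} {B' = B'} sel) =
  trans (cong (sizeTy τ +_) (Sel⇒sizeMTy≡ sel)) (x∙yz≈y∙xz (sizeTy τ) (sizeTy σ) (sizeMTy B'))

mutual
  ≈⇒sizeTy≡ : σ ≈ τ → sizeTy σ ≡ sizeTy τ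
  ≈⇒sizeTy≡ base          = refl
  ≈⇒sizeTy≡ (arr A≋B σ≈τ) = cong suc (cong₂ _+_ (≋⇒sizeMTy≡ A≋B) (≈⇒sizeTy≡ σ≈τ))

  ≋⇒sizeMTy≡ : A ≋ B → sizeMTy A ≡ sizeMTy B
  ≋⇒sizeMTy≡ nil                = refl
  ≋⇒sizeMTy≡ (cons σ≈σ' sel A≋B') =
    trans (cong₂ _+_ (≈⇒sizeTy≡ σ≈σ') (≋⇒sizeMTy≡ A≋B')) (sym (Sel⇒sizeMTy≡ sel))

≋[]⇒≡[] : A ≋ [] → A ≡ []
≋[]⇒≡[] nil            = refl
≋[]⇒≡[] (cons _ () _)

[]≋⇒≡[] : [] ≋ B → B ≡ []
[]≋⇒≡[] nil = refl

≈E⇒sizeEnv≡ : ∀ Γ Δ → Γ ≈E Δ → sizeEnv Γ ≡ sizeEnv Δ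
≈E⇒sizeEnv≡ []      []      Γ≈Δ = refl
≈E⇒sizeEnv≡ []      (B ∷ Δ) Γ≈Δ rewrite []≋⇒≡[] (Γ≈Δ 0) = ≈E⇒sizeEnv≡ [] Δ (Γ≈Δ ∘ suc)
≈E⇒sizeEnv≡ (A ∷ Γ) []      Γ≈Δ rewrite ≋[]⇒≡[] (Γ≈Δ 0) = ≈E⇒sizeEnv≡ Γ [] (Γ≈Δ ∘ suc)
≈E⇒sizeEnv≡ (A ∷ Γ) (B ∷ Δ) Γ≈Δ = cong₂ _+_ (≋⇒sizeMTy≡ (Γ≈Δ 0)) (≈E⇒sizeEnv≡ Γ Δ (Γ≈Δ ∘ suc))

mutual
  ≈-refl : ∀ σ → σ ≈ σ
  ≈-refl (base a) = base
  ≈-refl (A ⇒ τ)  = arr (≋-refl A) (≈-refl τ)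

  ≋-refl : ∀ A → A ≋ A
  ≋-refl []      = nil
  ≋-refl (σ ∷ A) = cons (≈-refl σ) here (≋-refl A)

-- Termination

-- Only the part of ρ not yet consumed by arguments counts for H x ρ Γ τ.  The `suc`s break the
-- ties between TI(Γ, [σ]) and its premise T(Γ, σ), and between H and the TI premise of (Head>0).
measure : Input → ℕ
measure (T Γ σ)     = sizeEnv Γ + sizeTy σ
measure (TI Γ A)    = suc (sizeEnv Γ + sizeMTy A)
measure (H x ρ Γ τ) = suc (sizeEnv Γ + (sizeTy ρ ∸ sizeTy τ))

≈I⇒measure≡ : ∀ {i j} → i ≈I j → measure i ≡ measure j
≈I⇒measure≡ (T {Γ} {Γ'} Γ≈Γ' σ≈σ') = cong₂ _+_ (≈E⇒sizeEnv≡ Γ Γ' Γ≈Γ') (≈⇒sizeTy≡ σ≈σ')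
≈I⇒measure≡ (TI {Γ} {Γ'} Γ≈Γ' A≋A') = cong suc (cong₂ _+_ (≈E⇒sizeEnv≡ Γ Γ' Γ≈Γ') (≋⇒sizeMTy≡ A≋A'))
≈I⇒measure≡ (H {Γ = Γ} {Γ'} ρ≈ρ' Γ≈Γ' τ≈τ') =
  cong suc (cong₂ _+_ (≈E⇒sizeEnv≡ Γ Γ' Γ≈Γ') (cong₂ _∸_ (≈⇒sizeTy≡ ρ≈ρ') (≈⇒sizeTy≡ τ≈τ')))

abs-premise-size< : ∀ Γ x A τ → sizeEnv (Γ ⊕ (x ↦ A)) + sizeTy τ < sizeEnv Γ + sizeTy (A ⇒ τ)
abs-premise-size< Γ x A τ = begin-strict
  sizeEnv (Γ ⊕ (x ↦ A)) + sizeTy τ   ≡⟨ cong (_+ sizeTy τ) (sizeEnv-⊕-↦ Γ x A) ⟩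
  sizeEnv Γ + sizeMTy A + sizeTy τ   ≡⟨ +-assoc (sizeEnv Γ) _ _ ⟩
  sizeEnv Γ + (sizeMTy A + sizeTy τ) <⟨ +-monoʳ-< (sizeEnv Γ) (n<1+n _) ⟩
  sizeEnv Γ + sizeTy (A ⇒ τ)         ∎
  where open ≤-Reasoning

union-premise-size≤ : ∀ {ps : List (Env × Ty)} → (Γ , σ) ∈ ps →
  sizeEnv Γ + sizeTy σ ≤ sizeEnv (ΣEnv (map proj₁ ps)) + sizeMTy (map proj₂ ps)
union-premise-size≤ Γσ∈ps =
  +-mono-≤ (∈⇒sizeEnv≤sizeEnv-ΣEnv (∈-map⁺ proj₁ Γσ∈ps)) (∈⇒sizeTy≤sizeMTy (∈-map⁺ proj₂ Γσ∈ps))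

Step⇒measure< : ∀ {i ps} → Step i ps → All (λ p → measure p < measure i) ps
Step⇒measure< (abs {Γ} {A} {τ} x _) = abs-premise-size< Γ x A τ ∷ []
Step⇒measure< (union ps) = Allₚ.map⁺ (All.tabulate λ { {Γ , σ} Γσ∈ps → s≤s (union-premise-size≤ Γσ∈ps) })
Step⇒measure< (head>0 {ρ = ρ} {B = B} {τ} Γ₁ Γ₂ ends) =
  s≤s (+-mono-≤-< (sizeEnv≤⊕ˡ Γ₁ Γ₂) (∸-monoʳ-< (s≤s (m≤n+m (sizeTy τ) (sizeMTy B))) (Ends⇒sizeTy≤ ends)))
  ∷ s≤s (+-mono-≤-< (sizeEnv≤⊕ʳ Γ₁ Γ₂) (m+n≤o⇒m≤o∸n (suc (sizeMTy B)) (Ends⇒sizeTy≤ ends)))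
  ∷ []
Step⇒measure< head0 = []
Step⇒measure< (head {x} {ρ} {τ = τ} Γ ends) = head-premise< ∷ []
  where
  open ≤-Reasoning
  head-premise< : suc (sizeEnv Γ + (sizeTy ρ ∸ sizeTy τ)) < sizeEnv (Γ ⊕ (x ↦ (ρ ∷ []))) + sizeTy τ
  head-premise< = begin-strict
    suc (sizeEnv Γ + (sizeTy ρ ∸ sizeTy τ)) ≡⟨ +-suc (sizeEnv Γ) _ ⟨
    sizeEnv Γ + suc (sizeTy ρ ∸ sizeTy τ)   ≤⟨ +-monoʳ-≤ (sizeEnv Γ) (∸-monoʳ-< (0<sizeTy τ) (Ends⇒sizeTy≤ ends)) ⟩
    sizeEnv Γ + sizeTy ρ                    <⟨ m<m+n _ (0<sizeTy τ) ⟩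
    sizeEnv Γ + sizeTy ρ + sizeTy τ         ≡⟨ cong (λ k → sizeEnv Γ + k + sizeTy τ) (+-identityʳ (sizeTy ρ)) ⟨
    sizeEnv Γ + sizeMTy (ρ ∷ []) + sizeTy τ ≡⟨ cong (_+ sizeTy τ) (sizeEnv-⊕-↦ Γ x (ρ ∷ [])) ⟨
    sizeEnv (Γ ⊕ (x ↦ (ρ ∷ []))) + sizeTy τ ∎

All-resp⁻-≈Is : ∀ {P : Input → Set} → (∀ {i j} → i ≈I j → P j → P i) →
                ∀ {ps qs} → ps ≈Is qs → All P qs → All P ps
All-resp⁻-≈Is resp []              []         = []
All-resp⁻-≈Is resp (p≈q ∷ ps≈qs) (Pq ∷ Pqs) = resp p≈q Pq ∷ All-resp⁻-≈Is resp ps≈qs Pqs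

Step≈⇒measure< : ∀ {i ps} → Step≈ i ps → All (λ p → measure p < measure i) ps
Step≈⇒measure< {i} (i' , ps' , i≈i' , ps≈ps' , rule) =
  All-resp⁻-≈Is (λ p≈q → subst (_< measure i) (sym (≈I⇒measure≡ p≈q))) ps≈ps'
    (subst (λ k → All (λ p → measure p < k) ps') (sym (≈I⇒measure≡ i≈i')) (Step⇒measure< rule))

Premise⇒measure< : ∀ {j i} → Premise j i → measure j < measure i
Premise⇒measure< (ps , step≈ , j∈ps) = All.lookup (Step≈⇒measure< step≈) j∈ps

Premise-wellFounded : WellFounded Premise
Premise-wellFounded = Subrelation.wellFounded Premise⇒measure< (On.wellFounded measure <-wellFounded)

-- Finite enumerations

listsUpTo : ∀ {X : Set} → ℕ → List X → List (List X)
listsUpTo zero    L = [] ∷ []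
listsUpTo (suc m) L = [] ∷ concatMap (λ x → map (x ∷_) (listsUpTo m L)) L

Any-listsUpTo : ∀ {X Y : Set} {R : X → Y → Set} {L : List Y} m {xs} → length xs ≤ m →
                All (λ x → Any (R x) L) xs → Any (Pointwise R xs) (listsUpTo m L)
Any-listsUpTo zero    {[]}     _         []               = here []
Any-listsUpTo (suc m) {[]}     _         []               = here []
Any-listsUpTo (suc m) {x ∷ xs} (s≤s len) (Rx∈L ∷ Rxs∈L) =
  there (Anyₚ.concatMap⁺ _ (Any.map (λ Rxy → Anyₚ.map⁺ (Any.map (Rxy ∷_) (Any-listsUpTo m len Rxs∈L))) Rx∈L))

∈-listsUpTo : ∀ {X : Set} {L : List X} m {xs} → length xs ≤ m → All (_∈ L) xs → xs ∈ listsUpTo m L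
∈-listsUpTo m len xs⊆L = Any.map Pointwise-≡⇒≡ (Any-listsUpTo m len xs⊆L)

typesUpTo : ℕ → List Ty
typesUpTo zero    = []
typesUpTo (suc k) = map base (upTo (suc k))
                    ++ concatMap (λ A → map (A ⇒_) (typesUpTo k)) (listsUpTo k (typesUpTo k))

mtysUpTo : ℕ → List MTy
mtysUpTo k = listsUpTo k (typesUpTo k)

mutual
  ∈-typesUpTo : ∀ k σ → sizeTy σ ≤ k → σ ∈ typesUpTo k
  ∈-typesUpTo (suc k) (base a) (s≤s a≤k) = ∈-++⁺ˡ (∈-map⁺ base (∈-upTo⁺ (s≤s a≤k)))
  ∈-typesUpTo (suc k) (A ⇒ τ)  (s≤s le)  = ∈-++⁺ʳ (map base (upTo (suc k)))
    (∈-concatMap⁺ _ (lose (∈-mtysUpTo k A (m+n≤o⇒m≤o _ le)) (∈-map⁺ (A ⇒_) (∈-typesUpTo k τ (m+n≤o⇒n≤o _ le)))))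

  ∈-mtysUpTo : ∀ k A → sizeMTy A ≤ k → A ∈ mtysUpTo k
  ∈-mtysUpTo k A le = ∈-listsUpTo k (≤-trans (length≤sizeMTy A) le) (All-∈-typesUpTo k A le)

  All-∈-typesUpTo : ∀ k A → sizeMTy A ≤ k → All (_∈ typesUpTo k) A
  All-∈-typesUpTo k []      le = []
  All-∈-typesUpTo k (σ ∷ A) le = ∈-typesUpTo k σ (m+n≤o⇒m≤o _ le) ∷ All-∈-typesUpTo k A (m+n≤o⇒n≤o _ le)

-- Environments with bounded domain

get-⊕ : ∀ Γ Δ x → get (Γ ⊕ Δ) x ≡ get Γ x ++ get Δ x
get-⊕ []      Δ       x       = refl
get-⊕ (A ∷ Γ) []      x       = sym (++-identityʳ _)
get-⊕ (A ∷ Γ) (B ∷ Δ) zero    = refl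
get-⊕ (A ∷ Γ) (B ∷ Δ) (suc x) = get-⊕ Γ Δ x

get-↦ : ∀ x A → get (x ↦ A) x ≡ A
get-↦ zero    A = refl
get-↦ (suc x) A = get-↦ x A

get-↦-≢ : ∀ x A {y} → x ≢ y → get (x ↦ A) y ≡ []
get-↦-≢ zero    A {zero}  x≢y = ⊥-elim (x≢y refl)
get-↦-≢ zero    A {suc y} _   = refl
get-↦-≢ (suc x) A {zero}  _   = refl
get-↦-≢ (suc x) A {suc y} x≢y = get-↦-≢ x A (x≢y ∘ cong suc)

record DomBelow (V : ℕ) (Γ : Env) : Set where
  constructor domBelow
  field get-≥ : ∀ x → V ≤ x → get Γ x ≡ []
open DomBelow

DomBelow-length : ∀ Γ → DomBelow (length Γ) Γ
DomBelow-length []      = domBelow λ _ _ → refl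
DomBelow-length (A ∷ Γ) = domBelow λ { (suc x) (s≤s le) → get-≥ (DomBelow-length Γ) x le }

DomBelow-mono : V ≤ W → DomBelow V Γ → DomBelow W Γ
DomBelow-mono V≤W dom = domBelow λ x W≤x → get-≥ dom x (≤-trans V≤W W≤x)

DomBelow-resp-≈E : Γ ≈E Δ → DomBelow V Γ → DomBelow V Δ
DomBelow-resp-≈E Γ≈Δ dom = domBelow λ x V≤x → []≋⇒≡[] (subst (_≋ _) (get-≥ dom x V≤x) (Γ≈Δ x))

DomBelow-resp⁻-≈E : Γ ≈E Δ → DomBelow V Δ → DomBelow V Γ
DomBelow-resp⁻-≈E Γ≈Δ dom = domBelow λ x V≤x → ≋[]⇒≡[] (subst (_ ≋_) (get-≥ dom x V≤x) (Γ≈Δ x))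

DomBelow-⊕ˡ : ∀ Γ Δ → DomBelow V (Γ ⊕ Δ) → DomBelow V Γ
DomBelow-⊕ˡ Γ Δ dom = domBelow λ x V≤x → ++-conicalˡ (get Γ x) _ (trans (sym (get-⊕ Γ Δ x)) (get-≥ dom x V≤x))

DomBelow-⊕ʳ : ∀ Γ Δ → DomBelow V (Γ ⊕ Δ) → DomBelow V Δ
DomBelow-⊕ʳ Γ Δ dom = domBelow λ x V≤x → ++-conicalʳ (get Γ x) _ (trans (sym (get-⊕ Γ Δ x)) (get-≥ dom x V≤x))

DomBelow-ΣEnv : ∀ {Γs} → DomBelow V (ΣEnv Γs) → Γ ∈ Γs → DomBelow V Γ
DomBelow-ΣEnv {Γs = Γ ∷ Γs} dom (here refl)  = DomBelow-⊕ˡ Γ (ΣEnv Γs) dom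
DomBelow-ΣEnv {Γs = Δ ∷ Γs} dom (there Γ∈Γs) = DomBelow-ΣEnv (DomBelow-⊕ʳ Δ (ΣEnv Γs) dom) Γ∈Γs

DomBelow-⊕-↦ : ∀ {x} → DomBelow V Γ → x < V → DomBelow V (Γ ⊕ (x ↦ A))
DomBelow-⊕-↦ {Γ = Γ} {A = A} {x} dom x<V = domBelow λ y V≤y → begin
  get (Γ ⊕ (x ↦ A)) y      ≡⟨ get-⊕ Γ (x ↦ A) y ⟩
  get Γ y ++ get (x ↦ A) y ≡⟨ cong₂ _++_ (get-≥ dom y V≤y) (get-↦-≢ x A (<⇒≢ (<-≤-trans x<V V≤y))) ⟩
  []                       ∎
  where open ≡-Reasoning

DomBelow-↦⇒< : ∀ {x} → DomBelow V (x ↦ (σ ∷ A)) → x < V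
DomBelow-↦⇒< {σ = σ} {A = A} {x = x} dom = ≰⇒> λ V≤x → ∷≢[] (trans (sym (get-↦ x (σ ∷ A))) (get-≥ dom x V≤x))
  where
  ∷≢[] : σ ∷ A ≢ []
  ∷≢[] ()

take-≈E : ∀ V Γ → DomBelow V Γ → Γ ≈E take V Γ
take-≈E zero    Γ       dom x       = subst (_≋ []) (sym (get-≥ dom x z≤n)) nil
take-≈E (suc V) []      dom x       = nil
take-≈E (suc V) (A ∷ Γ) dom zero    = ≋-refl A
take-≈E (suc V) (A ∷ Γ) dom (suc x) = take-≈E V Γ (domBelow λ y le → get-≥ dom (suc y) (s≤s le)) x

envsUpTo : ℕ → ℕ → List Env
envsUpTo n V = listsUpTo V (mtysUpTo n)

take-∈-envsUpTo : ∀ n V Γ → sizeEnv Γ ≤ n → take V Γ ∈ envsUpTo n V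
take-∈-envsUpTo n V Γ le = ∈-listsUpTo V (≤-trans (≤-reflexive (length-take V Γ)) (m⊓n≤m V _))
  (Allₚ.take⁺ V (All.tabulate λ A∈Γ → ∈-mtysUpTo n _ (≤-trans (∈⇒sizeMTy≤sizeEnv A∈Γ) le)))

-- Bounded inputs

envOf : Input → Env
envOf (T Γ _)     = Γ
envOf (TI Γ _)    = Γ
envOf (H _ _ Γ _) = Γ

withEnv : Env → Input → Input
withEnv Δ (T _ σ)     = T Δ σ
withEnv Δ (TI _ A)    = TI Δ A
withEnv Δ (H x ρ _ τ) = H x ρ Δ τ

typeSize : Input → ℕ
typeSize (T _ σ)     = sizeTy σ
typeSize (TI _ A)    = sizeMTy A
typeSize (H _ ρ _ _) = sizeTy ρ

bulk : Input → ℕ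
bulk i = sizeEnv (envOf i) + typeSize i

goalSize : Input → ℕ
goalSize (H _ _ _ τ) = sizeTy τ
goalSize _           = 0

headVarBound : Input → ℕ
headVarBound (H x _ _ _) = suc x
headVarBound _           = 0

record Bounded (n V : ℕ) (i : Input) : Set where
  constructor bounded
  field
    bulk≤     : bulk i ≤ n
    goalSize≤ : goalSize i ≤ n
    headVar≤  : headVarBound i ≤ V
    envDom    : DomBelow V (envOf i)
open Bounded

≈I⇒envOf≈E : ∀ {i j} → i ≈I j → envOf i ≈E envOf j
≈I⇒envOf≈E (T Γ≈Γ' _)   = Γ≈Γ'
≈I⇒envOf≈E (TI Γ≈Γ' _)  = Γ≈Γ'
≈I⇒envOf≈E (H _ Γ≈Γ' _) = Γ≈Γ'

≈I⇒bulk≡ : ∀ {i j} → i ≈I j → bulk i ≡ bulk j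
≈I⇒bulk≡ {i} {j} i≈j = cong₂ _+_ (≈E⇒sizeEnv≡ (envOf i) (envOf j) (≈I⇒envOf≈E i≈j)) (typeSize≡ i≈j)
  where
  typeSize≡ : ∀ {i j} → i ≈I j → typeSize i ≡ typeSize j
  typeSize≡ (T _ σ≈σ')   = ≈⇒sizeTy≡ σ≈σ'
  typeSize≡ (TI _ A≋A')  = ≋⇒sizeMTy≡ A≋A'
  typeSize≡ (H ρ≈ρ' _ _) = ≈⇒sizeTy≡ ρ≈ρ'

≈I⇒goalSize≡ : ∀ {i j} → i ≈I j → goalSize i ≡ goalSize j
≈I⇒goalSize≡ (T _ _)      = refl
≈I⇒goalSize≡ (TI _ _)     = refl
≈I⇒goalSize≡ (H _ _ τ≈τ') = ≈⇒sizeTy≡ τ≈τ'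

≈I⇒headVarBound≡ : ∀ {i j} → i ≈I j → headVarBound i ≡ headVarBound j
≈I⇒headVarBound≡ (T _ _)   = refl
≈I⇒headVarBound≡ (TI _ _)  = refl
≈I⇒headVarBound≡ (H _ _ _) = refl

Bounded-resp-≈I : ∀ {i j} → i ≈I j → Bounded n V i → Bounded n V j
Bounded-resp-≈I {n} {V} i≈j (bounded b g h d) = bounded
  (subst (_≤ n) (≈I⇒bulk≡ i≈j) b) (subst (_≤ n) (≈I⇒goalSize≡ i≈j) g)
  (subst (_≤ V) (≈I⇒headVarBound≡ i≈j) h) (DomBelow-resp-≈E (≈I⇒envOf≈E i≈j) d)

Bounded-resp⁻-≈I : ∀ {i j} → i ≈I j → Bounded n V j → Bounded n V i
Bounded-resp⁻-≈I {n} {V} i≈j (bounded b g h d) = bounded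
  (subst (_≤ n) (sym (≈I⇒bulk≡ i≈j)) b) (subst (_≤ n) (sym (≈I⇒goalSize≡ i≈j)) g)
  (subst (_≤ V) (sym (≈I⇒headVarBound≡ i≈j)) h) (DomBelow-resp⁻-≈E (≈I⇒envOf≈E i≈j) d)

Bounded-initial : ∀ i → Bounded (bulk i + goalSize i) (headVarBound i + length (envOf i)) i
Bounded-initial i =
  bounded (m≤m+n _ _) (m≤n+m _ _) (m≤m+n _ _) (DomBelow-mono (m≤n+m _ _) (DomBelow-length (envOf i)))

inputsAt : ℕ → ℕ → Env → List Input
inputsAt n V Γ = map (T Γ) (typesUpTo n) ++ map (TI Γ) (mtysUpTo n)
  ++ concatMap (λ x → concatMap (λ ρ → map (H x ρ Γ) (typesUpTo n)) (typesUpTo n)) (upTo V)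

inputsUpTo : ℕ → ℕ → List Input
inputsUpTo n V = concatMap (inputsAt n V) (envsUpTo n V)

withEnv-∈-inputsAt : ∀ {i} Δ → Bounded n V i → withEnv Δ i ∈ inputsAt n V Δ
withEnv-∈-inputsAt {n} {i = T Γ σ} Δ (bounded b _ _ _) =
  ∈-++⁺ˡ (∈-map⁺ (T Δ) (∈-typesUpTo n σ (m+n≤o⇒n≤o _ b)))
withEnv-∈-inputsAt {n} {i = TI Γ A} Δ (bounded b _ _ _) =
  ∈-++⁺ʳ (map (T Δ) (typesUpTo n)) (∈-++⁺ˡ (∈-map⁺ (TI Δ) (∈-mtysUpTo n A (m+n≤o⇒n≤o _ b))))
withEnv-∈-inputsAt {n} {i = H x ρ Γ τ} Δ (bounded b g (s≤s x<V) _) =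
  ∈-++⁺ʳ (map (T Δ) (typesUpTo n)) (∈-++⁺ʳ (map (TI Δ) (mtysUpTo n))
    (∈-concatMap⁺ _ (lose (∈-upTo⁺ (s≤s x<V)) (∈-concatMap⁺ _
      (lose (∈-typesUpTo n ρ (m+n≤o⇒n≤o _ b)) (∈-map⁺ (H x ρ Δ) (∈-typesUpTo n τ g)))))))

≈I-withEnv : ∀ i {Δ} → envOf i ≈E Δ → i ≈I withEnv Δ i
≈I-withEnv (T Γ σ)     Γ≈Δ = T Γ≈Δ (≈-refl σ)
≈I-withEnv (TI Γ A)    Γ≈Δ = TI Γ≈Δ (≋-refl A)
≈I-withEnv (H x ρ Γ τ) Γ≈Δ = H (≈-refl ρ) Γ≈Δ (≈-refl τ)

record Canonical (n V : ℕ) (i : Input) : Set where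
  field
    rep   : Input
    rep∈  : rep ∈ inputsUpTo n V
    ≈rep  : i ≈I rep

canonical : ∀ {i} → Bounded n V i → Canonical n V i
canonical {n} {V} {i} b = record
  { rep  = withEnv Γ' i
  ; rep∈ = ∈-concatMap⁺ _ (lose (take-∈-envsUpTo n V (envOf i) (m+n≤o⇒m≤o _ (bulk≤ b))) (withEnv-∈-inputsAt Γ' b))
  ; ≈rep = ≈I-withEnv i (take-≈E V (envOf i) (envDom b))
  }
  where Γ' = take V (envOf i)

-- Finitely many runs

Pointwise⇒≈Ts : ∀ {ts us} → Pointwise _≈T_ ts us → ts ≈Ts us
Pointwise⇒≈Ts []            = []
Pointwise⇒≈Ts (t≈u ∷ ts≈us) = t≈u ∷ Pointwise⇒≈Ts ts≈us

≈Is⇒length≡ : ∀ {ps qs} → ps ≈Is qs → length ps ≡ length qs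
≈Is⇒length≡ []          = refl
≈Is⇒length≡ (_ ∷ ps≈qs) = cong suc (≈Is⇒length≡ ps≈qs)

length-eraseAll : ∀ {fresh ps} (rs : All (Run fresh) ps) → length (eraseAll rs) ≡ length ps
length-eraseAll []       = refl
length-eraseAll (_ ∷ rs) = cong suc (length-eraseAll rs)

Step⇒length≤ : ∀ {i ps} → Step i ps → length ps ≤ 2 + bulk i
Step⇒length≤ (abs _ _)      = s≤s z≤n
Step⇒length≤ (union ps)     = begin
  length (map TOf ps)                            ≡⟨ length-map TOf ps ⟩
  length ps                                      ≡⟨ length-map proj₂ ps ⟨
  length (map proj₂ ps)                          ≤⟨ length≤sizeMTy (map proj₂ ps) ⟩
  sizeMTy (map proj₂ ps)                         ≤⟨ m≤n+m _ _ ⟩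
  bulk (TI (ΣEnv (map proj₁ ps)) (map proj₂ ps)) ≤⟨ m≤n+m _ 2 ⟩
  2 + bulk (TI (ΣEnv (map proj₁ ps)) (map proj₂ ps)) ∎
  where open ≤-Reasoning
Step⇒length≤ (head>0 _ _ _) = s≤s (s≤s z≤n)
Step⇒length≤ head0          = z≤n
Step⇒length≤ (head _ _)     = s≤s z≤n

module RunShapes (fresh : Env → Var) (fresh-resp : (Γ Δ : Env) → Γ ≈E Δ → fresh Γ ≡ fresh Δ) (n : ℕ) where

  -- Fresh names are chosen for environments ≈E to one of the finitely many in envsUpTo n V.
  nextBound : ℕ → ℕ
  nextBound V = suc (max V (map fresh (envsUpTo n V)))

  ≤nextBound : ∀ V → V ≤ nextBound V
  ≤nextBound V = m≤n⇒m≤1+n (⊥≤max V (map fresh (envsUpTo n V)))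

  fresh<nextBound : sizeEnv Γ ≤ n → DomBelow V Γ → fresh Γ < nextBound V
  fresh<nextBound {Γ} {V} Γ≤n dom = s≤s (begin
    fresh Γ                          ≡⟨ fresh-resp Γ (take V Γ) (take-≈E V Γ dom) ⟩
    fresh (take V Γ)                 ≤⟨ All.lookup (xs≤max V (map fresh (envsUpTo n V))) (∈-map⁺ fresh (take-∈-envsUpTo n V Γ Γ≤n)) ⟩
    max V (map fresh (envsUpTo n V)) ∎)
    where open ≤-Reasoning

  Step⇒Bounded : ∀ {i ps} (rule : Step i ps) → FreshOK fresh rule →
                 Bounded n V i → All (Bounded n (nextBound V)) ps
  Step⇒Bounded {V} (abs {Γ} {A} {τ} x _) x≡fresh (bounded b _ _ d) =
    bounded (≤-trans (<⇒≤ (abs-premise-size< Γ x A τ)) b) z≤n z≤n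
      (DomBelow-⊕-↦ (DomBelow-mono (≤nextBound V) d)
        (subst (_< nextBound V) (sym x≡fresh) (fresh<nextBound (m+n≤o⇒m≤o _ b) d)))
    ∷ []
  Step⇒Bounded {V} (union ps) _ (bounded b _ _ d) = Allₚ.map⁺ (All.tabulate λ
    { {Γ , σ} Γσ∈ps → bounded (≤-trans (union-premise-size≤ Γσ∈ps) b) z≤n z≤n
        (DomBelow-mono (≤nextBound V) (DomBelow-ΣEnv d (∈-map⁺ proj₁ Γσ∈ps))) })
  Step⇒Bounded {V} (head>0 {ρ = ρ} {B = B} Γ₁ Γ₂ ends) _ (bounded b _ h d) =
    bounded (≤-trans (+-monoˡ-≤ _ (sizeEnv≤⊕ˡ Γ₁ Γ₂)) b) (≤-trans (Ends⇒sizeTy≤ ends) (m+n≤o⇒n≤o _ b))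
      (≤-trans h (≤nextBound V)) (DomBelow-mono (≤nextBound V) (DomBelow-⊕ˡ Γ₁ Γ₂ d))
    ∷ bounded (≤-trans (+-mono-≤ (sizeEnv≤⊕ʳ Γ₁ Γ₂) B≤ρ) b) z≤n z≤n
      (DomBelow-mono (≤nextBound V) (DomBelow-⊕ʳ Γ₁ Γ₂ d))
    ∷ []
    where
    B≤ρ : sizeMTy B ≤ sizeTy ρ
    B≤ρ = ≤-trans (m≤n⇒m≤1+n (m≤m+n (sizeMTy B) _)) (Ends⇒sizeTy≤ ends)
  Step⇒Bounded head0 _ _ = []
  Step⇒Bounded {V} (head {x} {ρ} Γ _) _ (bounded b _ _ d) =
    bounded (≤-trans (≤-reflexive Γρ≡) (m+n≤o⇒m≤o _ b)) (m+n≤o⇒n≤o _ b)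
      (≤-trans (DomBelow-↦⇒< (DomBelow-⊕ʳ Γ _ d)) (≤nextBound V))
      (DomBelow-mono (≤nextBound V) (DomBelow-⊕ˡ Γ _ d))
    ∷ []
    where
    Γρ≡ : sizeEnv Γ + sizeTy ρ ≡ sizeEnv (Γ ⊕ (x ↦ (ρ ∷ [])))
    Γρ≡ = trans (cong (sizeEnv Γ +_) (sym (+-identityʳ _))) (sym (sizeEnv-⊕-↦ Γ x (ρ ∷ [])))

  treesUpTo : ℕ → ℕ → List Tree
  treesUpTo zero    V = []
  treesUpTo (suc d) V = map pending (inputsUpTo n V)
    ++ concatMap (λ s → map (node s) (listsUpTo (2 + n) (treesUpTo d (nextBound V)))) (inputsUpTo n V)

  mutual
    erase∈treesUpTo : ∀ {d V i} → Bounded n V i → measure i < d → (r : Run fresh i) →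
                      Any (erase r ≈T_) (treesUpTo d V)
    erase∈treesUpTo {suc d} b _ stop = Anyₚ.++⁺ˡ (Anyₚ.map⁺ (lose rep∈ (pending ≈rep)))
      where open Canonical (canonical b)
    erase∈treesUpTo {suc d} {V} b (s≤s μ≤d) (node {i' = i'} {ps} {ps'} i≈i' ps≈ps' rule fresh-ok rs) =
      Anyₚ.++⁺ʳ (map pending (inputsUpTo n V)) (Anyₚ.concatMap⁺ _ (lose rep∈ (Anyₚ.map⁺
        (Any.map (node ≈rep ∘ Pointwise⇒≈Ts) (Any-listsUpTo (2 + n) children≤ (eraseAll∈treesUpTo rs bs μs))))))
      where
      open Canonical (canonical b)
      b' = Bounded-resp-≈I i≈i' b
      bs : All (Bounded n (nextBound V)) ps
      bs = All-resp⁻-≈Is Bounded-resp⁻-≈I ps≈ps' (Step⇒Bounded rule fresh-ok b')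
      μs : All (λ p → measure p < d) ps
      μs = All.map (λ μ< → <-≤-trans μ< μ≤d) (Step≈⇒measure< (i' , ps' , i≈i' , ps≈ps' , rule))
      children≤ : length (eraseAll rs) ≤ 2 + n
      children≤ = begin
        length (eraseAll rs) ≡⟨ length-eraseAll rs ⟩
        length ps            ≡⟨ ≈Is⇒length≡ ps≈ps' ⟩
        length ps'           ≤⟨ Step⇒length≤ rule ⟩
        2 + bulk i'          ≤⟨ +-monoʳ-≤ 2 (bulk≤ b') ⟩
        2 + n                ∎
        where open ≤-Reasoning

    eraseAll∈treesUpTo : ∀ {d V ps} (rs : All (Run fresh) ps) → All (Bounded n V) ps →
                         All (λ p → measure p < d) ps → All (λ t → Any (t ≈T_) (treesUpTo d V)) (eraseAll rs)
    eraseAll∈treesUpTo []       []       []       = []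
    eraseAll∈treesUpTo (r ∷ rs) (b ∷ bs) (μ ∷ μs) = erase∈treesUpTo b μ r ∷ eraseAll∈treesUpTo rs bs μs

runs-finite : (fresh : Env → Var) → ((Γ Δ : Env) → Γ ≈E Δ → fresh Γ ≡ fresh Δ) → (i : Input) →
              Σ (List Tree) (λ L → (r : Run fresh i) → Any (λ t → erase r ≈T t) L)
runs-finite fresh fresh-resp i =
  treesUpTo (suc (measure i)) (headVarBound i + length (envOf i)) , erase∈treesUpTo (Bounded-initial i) ≤-refl
  where open RunShapes fresh fresh-resp (bulk i + goalSize i)

-- (Abs) itself requires the bound variable to be outside dom Γ.
lemma3p16 : ((i : Input) → Acc Premise i)
            × ((fresh : Env → Var) →
               ((Γ : Env) → get Γ (fresh Γ) ≡ []) →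
               ((Γ Δ : Env) → Γ ≈E Δ → fresh Γ ≡ fresh Δ) →
               (i : Input) →
               Σ (List Tree) (λ L → (r : Run fresh i) → Any (λ t → erase r ≈T t) L))
lemma3p16 = Premise-wellFounded , λ fresh _ → runs-finite fresh
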